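{- Let $\mathsf{HoGph}$ be the category whose objects are graphs and whose morphisms $G\to H$ are homotopy classes $[f]$ of graph morphisms $f:G\to H$, with composition $[g][f]=[gf]$, and let $\Psi:\mathsf{Gph}\to\mathsf{HoGph}$ be the functor that is the identity on objects and sends $f$ to $[f]$. Then for every category $\mathcal{C}$ and every functor $F:\mathsf{Gph}\to\mathcal{C}$ that sends homotopy equivalences to isomorphisms, there is a unique functor $F':\mathsf{HoGph}\to\mathcal{C}$ with $F'\Psi=F$.
   Context: $\mathsf{Gph}$ is the category of graphs (finite undirected graphs, loops allowed, at most one edge between two vertices) and graph morphisms (vertex maps preserving edges). The exponential graph $H^G$ has as vertices the set maps $V(G)\to V(H)$, with $f\text{ --- }g$ iff $f(v_1)\text{ --- }g(v_2)$ for every edge $v_1\text{ --- }v_2$ of $G$ (loops included). Morphisms $f,g:G\to H$ are homotopic if there is a sequence of graph morphisms $f=f_0,\dots,f_n=g$ with $f_i\text{ --- }f_{i+1}$ in $H^G$; this is an equivalence relation compatible with composition, and $[f]$ denotes the class of $f$. A morphism $f:G\to H$ is a homotopy equivalence if there is $g:H\to G$ with $gf$ homotopic to $\mathrm{id}_G$ and $fg$ homotopic to $\mathrm{id}_H$. -}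

module Defs where

open import Level using (Level; _⊔_) renaming (suc to lsuc; zero to lzero)
open import Data.Nat using (ℕ)
open import Data.Fin using (Fin)
open import Data.Bool using (Bool; T)
open import Data.Product using (Σ; _×_; _,_)
open import Relation.Binary using (Rel; IsEquivalence)
open import Relation.Binary.PropositionalEquality
  using (_≡_; refl; sym; trans; cong; subst; subst₂)

-- Categories with hom-setoids (no quotient types are available, so a
-- category carries an equivalence relation _≈_ on each hom-set).

record Category (o ℓ e : Level) : Set (lsuc (o ⊔ ℓ ⊔ e)) where
  infix  4 _≈_
  infixr 9 _∘_
  field
    Obj       : Set o
    Hom       : Obj → Obj → Set ℓ
    _≈_       : ∀ {A B} → Rel (Hom A B) e
    id        : ∀ {A} → Hom A A
    _∘_       : ∀ {A B C} → Hom B C → Hom A B → Hom A C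
    ≈-equiv   : ∀ {A B} → IsEquivalence (_≈_ {A} {B})
    ∘-resp-≈  : ∀ {A B C} {f g : Hom B C} {h i : Hom A B} →
                f ≈ g → h ≈ i → f ∘ h ≈ g ∘ i
    assoc     : ∀ {A B C D} {f : Hom A B} {g : Hom B C} {h : Hom C D} →
                (h ∘ g) ∘ f ≈ h ∘ (g ∘ f)
    identityˡ : ∀ {A B} {f : Hom A B} → id ∘ f ≈ f
    identityʳ : ∀ {A B} {f : Hom A B} → f ∘ id ≈ f

open Category using (Obj; Hom)

IsIso : ∀ {o ℓ e} (C : Category o ℓ e) {A B : Category.Obj C} →
        Category.Hom C A B → Set (ℓ ⊔ e)
IsIso C {A} {B} f =
  Σ (Hom C B A) λ g → (C ._≈_ (C ._∘_ g f) (Category.id C)) ×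
                      (C ._≈_ (C ._∘_ f g) (Category.id C))
  where open Category

record Functor {o ℓ e o′ ℓ′ e′} (C : Category o ℓ e) (D : Category o′ ℓ′ e′)
       : Set (o ⊔ ℓ ⊔ e ⊔ o′ ⊔ ℓ′ ⊔ e′) where
  private
    module C = Category C
    module D = Category D
  field
    F₀           : C.Obj → D.Obj
    F₁           : ∀ {A B} → C.Hom A B → D.Hom (F₀ A) (F₀ B)
    F-resp-≈     : ∀ {A B} {f g : C.Hom A B} → f C.≈ g → F₁ f D.≈ F₁ g
    identity     : ∀ {A} → F₁ (C.id {A}) D.≈ D.id
    homomorphism : ∀ {A B X} {f : C.Hom A B} {g : C.Hom B X} →
                   F₁ (g C.∘ f) D.≈ F₁ g D.∘ F₁ f

open Functor

_∘F_ : ∀ {o ℓ e o′ ℓ′ e′ o″ ℓ″ e″}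
         {C : Category o ℓ e} {D : Category o′ ℓ′ e′} {E : Category o″ ℓ″ e″} →
       Functor D E → Functor C D → Functor C E
_∘F_ {C = C} {D} {E} G F = record
  { F₀ = λ A → F₀ G (F₀ F A)
  ; F₁ = λ f → F₁ G (F₁ F f)
  ; F-resp-≈ = λ p → F-resp-≈ G (F-resp-≈ F p)
  ; identity = IsEquivalence.trans (Category.≈-equiv E)
                 (F-resp-≈ G (identity F)) (identity G)
  ; homomorphism = IsEquivalence.trans (Category.≈-equiv E)
                 (F-resp-≈ G (homomorphism F)) (homomorphism G)
  }

record _≡F_ {o ℓ e o′ ℓ′ e′} {C : Category o ℓ e} {D : Category o′ ℓ′ e′}
            (F G : Functor C D) : Set (o ⊔ ℓ ⊔ e ⊔ o′ ⊔ ℓ′ ⊔ e′) where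
  field
    eq₀ : ∀ X → F₀ F X ≡ F₀ G X
    eq₁ : ∀ {X Y} (f : Category.Hom C X Y) →
          Category._≈_ D (subst₂ (Category.Hom D) (eq₀ X) (eq₀ Y) (F₁ F f))
                         (F₁ G f)

-- Graphs: finite (vertex set Fin size), undirected (symmetric adjacency),
-- loops allowed, at most one edge between two vertices (Bool adjacency).

record Graph : Set where
  field
    size    : ℕ
    adj     : Fin size → Fin size → Bool
    adj-sym : ∀ x y → adj x y ≡ adj y x

V : Graph → Set
V G = Fin (Graph.size G)

Edge : (G : Graph) → V G → V G → Set
Edge G x y = T (Graph.adj G x y)

edge-sym : (G : Graph) {x y : V G} → Edge G x y → Edge G y x
edge-sym G {x} {y} = subst T (Graph.adj-sym G x y)

record Mor (G H : Graph) : Set where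
  constructor mor
  field
    fun  : V G → V H
    pres : ∀ {x y} → Edge G x y → Edge H (fun x) (fun y)

open Mor

idMor : ∀ {G} → Mor G G
idMor = mor (λ x → x) (λ e → e)

_∘M_ : ∀ {G H K} → Mor H K → Mor G H → Mor G K
g ∘M f = mor (λ x → fun g (fun f x)) (λ e → pres g (pres f e))

_≐_ : ∀ {G H} → Rel (Mor G H) lzero
f ≐ g = ∀ v → fun f v ≡ fun g v

ExpAdj : (G H : Graph) → (V G → V H) → (V G → V H) → Set
ExpAdj G H f g = ∀ v₁ v₂ → Edge G v₁ v₂ → Edge H (f v₁) (g v₂)

data Homotopic {G H : Graph} : Mor G H → Mor G H → Set where
  done : ∀ {f g} → f ≐ g → Homotopic f g
  step : ∀ {f g h} → ExpAdj G H (fun f) (fun g) → Homotopic g h → Homotopic f h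

IsHomotopyEquivalence : ∀ {G H} → Mor G H → Set
IsHomotopyEquivalence {G} {H} f =
  Σ (Mor H G) λ g → Homotopic (g ∘M f) idMor × Homotopic (f ∘M g) idMor

private
  ≐-trans : ∀ {G H} {f g h : Mor G H} → f ≐ g → g ≐ h → f ≐ h
  ≐-trans p q v = trans (p v) (q v)

  h-refl : ∀ {G H} {f : Mor G H} → Homotopic f f
  h-refl = done (λ _ → refl)

  h-trans : ∀ {G H} {f g h : Mor G H} → Homotopic f g → Homotopic g h → Homotopic f h
  h-trans {f = f} {g} {h} (done p) (done q) = done (≐-trans {f = f} {g} {h} p q)
  h-trans {G} {H} {f} (done p) (step {g = k} a r) =
    step (λ v₁ v₂ e → subst (λ z → Edge H z (fun k v₂)) (sym (p v₁)) (a v₁ v₂ e)) r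
  h-trans (step a r) q = step a (h-trans r q)

  adj-sym′ : ∀ {G H} {f g : V G → V H} → ExpAdj G H f g → ExpAdj G H g f
  adj-sym′ {G} {H} a v₁ v₂ e = edge-sym H (a v₂ v₁ (edge-sym G e))

  h-sym : ∀ {G H} {f g : Mor G H} → Homotopic f g → Homotopic g f
  h-sym (done p) = done (λ v → sym (p v))
  h-sym {G} {H} (step {f} {g} a r) =
    h-trans (h-sym r) (step (adj-sym′ {G} {H} {fun f} {fun g} a) h-refl)

  post : ∀ {G H K} (k : Mor H K) {f g : Mor G H} →
         Homotopic f g → Homotopic (k ∘M f) (k ∘M g)
  post k (done p) = done (λ v → cong (fun k) (p v))
  post k (step a r) = step (λ v₁ v₂ e → pres k (a v₁ v₂ e)) (post k r)

  pre : ∀ {G H K} (f : Mor G H) {h i : Mor H K} →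
        Homotopic h i → Homotopic (h ∘M f) (i ∘M f)
  pre f (done p) = done (λ v → p (fun f v))
  pre f (step a r) = step (λ v₁ v₂ e → a _ _ (pres f e)) (pre f r)

  h-∘ : ∀ {G H K} {f g : Mor H K} {h i : Mor G H} →
        Homotopic f g → Homotopic h i → Homotopic (f ∘M h) (g ∘M i)
  h-∘ {f = f} {i = i} p q = h-trans (post f q) (pre i p)

Gph : Category lzero lzero lzero
Gph = record
  { Obj = Graph
  ; Hom = Mor
  ; _≈_ = _≐_
  ; id = idMor
  ; _∘_ = _∘M_
  ; ≈-equiv = record { refl = λ _ → refl
                     ; sym = λ p v → sym (p v)
                     ; trans = λ {f} {g} {h} → ≐-trans {f = f} {g} {h} }
  ; ∘-resp-≈ = λ {_} {_} {_} {f} {g} {h} {i} p q v →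
                 trans (cong (fun f) (q v)) (p (fun i v))
  ; assoc = λ _ → refl
  ; identityˡ = λ _ → refl
  ; identityʳ = λ _ → refl
  }

HoGph : Category lzero lzero lzero
HoGph = record
  { Obj = Graph
  ; Hom = Mor
  ; _≈_ = Homotopic
  ; id = idMor
  ; _∘_ = _∘M_
  ; ≈-equiv = record { refl = h-refl ; sym = h-sym ; trans = h-trans }
  ; ∘-resp-≈ = h-∘
  ; assoc = h-refl
  ; identityˡ = h-refl
  ; identityʳ = h-refl
  }

Ψ : Functor Gph HoGph
Ψ = record
  { F₀ = λ G → G
  ; F₁ = λ f → f
  ; F-resp-≈ = done
  ; identity = h-refl
  ; homomorphism = h-refl
  }

InvertsHomotopyEquivalences : ∀ {o ℓ e} {C : Category o ℓ e} →
                              Functor Gph C → Set (ℓ ⊔ e)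
InvertsHomotopyEquivalences {C = C} F =
  ∀ {G H} (f : Mor G H) → IsHomotopyEquivalence f → IsIso C (F₁ F f)

module Submission where

-- Every graph G has a cylinder Cyl G: two copies of G, with (x,i)
-- adjacent to (y,j) iff x is adjacent to y in G.  Its projection
-- p : Cyl G → G has the two inclusions i₀, i₁ as sections, and i₀ ∘ p is
-- adjacent to the identity in the exponential graph, so p is a homotopy
-- equivalence.  Moreover an adjacency f — g in H^G is exactly a morphism
-- h : Cyl G → H with h ∘ i₀ = f and h ∘ i₁ = g.
--
-- If F inverts homotopy equivalences, F p is an isomorphism, hence
-- cancellable on the left; as p ∘ i₀ = p ∘ i₁, we get F i₀ ≈ F i₁, and
-- therefore F f ≈ F (h ∘ i₀) ≈ F (h ∘ i₁) ≈ F g for adjacent f, g.  By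
-- induction along a homotopy, F identifies homotopic morphisms, so F itself
-- is a functor F′ on HoGph with F′ Ψ = F.  Since Ψ is the identity on objects
-- and morphisms, any F″ with F″ Ψ = F agrees with F′, which gives uniqueness.

open import Defs
open import Data.Product using (Σ; _×_; _,_)
open import Data.Fin using (Fin; splitAt; _↑ˡ_; _↑ʳ_)
open import Data.Fin.Properties using (splitAt-↑ˡ; splitAt-↑ʳ)
open import Data.Sum using (_⊎_; inj₁; inj₂; [_,_]′; reduce)
open import Relation.Binary using (IsEquivalence; Setoid)
import Relation.Binary.Reasoning.Setoid as SetoidReasoning
open import Data.Nat using (_+_)
open import Relation.Binary.PropositionalEquality as ≡ using (_≡_)
open Mor
open Functor

homSetoid : ∀ {o ℓ e} (C : Category o ℓ e) (A B : Category.Obj C) →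
            Setoid _ _
homSetoid C A B = record
  { Carrier = Category.Hom C A B
  ; _≈_ = Category._≈_ C
  ; isEquivalence = Category.≈-equiv C }

module HomLaws {o ℓ e} (C : Category o ℓ e) where
  open Category C

  ≈-refl : ∀ {A B} {f : Hom A B} → f ≈ f
  ≈-refl = IsEquivalence.refl ≈-equiv

  ≈-sym : ∀ {A B} {f g : Hom A B} → f ≈ g → g ≈ f
  ≈-sym = IsEquivalence.sym ≈-equiv

  ≈-trans : ∀ {A B} {f g h : Hom A B} → f ≈ g → g ≈ h → f ≈ h
  ≈-trans = IsEquivalence.trans ≈-equiv

iso-cancelˡ : ∀ {o ℓ e} (C : Category o ℓ e) {X A B : Category.Obj C}
              {f : Category.Hom C A B} {a b : Category.Hom C X A} →
              IsIso C f → Category._≈_ C (Category._∘_ C f a) (Category._∘_ C f b) →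
              Category._≈_ C a b
iso-cancelˡ C {X} {A} {f = f} {a} {b} (g , g∘f≈id , _) fa≈fb = begin
  a             ≈⟨ ≈-sym identityˡ ⟩
  id ∘ a        ≈⟨ ∘-resp-≈ (≈-sym g∘f≈id) ≈-refl ⟩
  (g ∘ f) ∘ a   ≈⟨ assoc ⟩
  g ∘ (f ∘ a)   ≈⟨ ∘-resp-≈ ≈-refl fa≈fb ⟩
  g ∘ (f ∘ b)   ≈⟨ ≈-sym assoc ⟩
  (g ∘ f) ∘ b   ≈⟨ ∘-resp-≈ g∘f≈id ≈-refl ⟩
  id ∘ b        ≈⟨ identityˡ ⟩
  b             ∎
  where
    open Category C
    open HomLaws C
    open SetoidReasoning (homSetoid C X A)

-- The cylinder on G.  Its vertices are Fin (n + n), read through splitAt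
-- as two copies of V G; `base` forgets which copy a vertex lies in, and
-- two vertices are adjacent iff their bases are.
module Cylinder (G : Graph) where
  private n = Graph.size G

  base : Fin (n + n) → V G
  base x = reduce (splitAt n x)

  base-↑ˡ : ∀ a → base (a ↑ˡ n) ≡ a
  base-↑ˡ a = ≡.cong reduce (splitAt-↑ˡ n a n)

  base-↑ʳ : ∀ a → base (n ↑ʳ a) ≡ a
  base-↑ʳ a = ≡.cong reduce (splitAt-↑ʳ n n a)

  Cyl : Graph
  Cyl = record
    { size = _
    ; adj = λ x y → Graph.adj G (base x) (base y)
    ; adj-sym = λ x y → Graph.adj-sym G (base x) (base y) }

  p : Mor Cyl G
  p = mor base (λ e → e)

  i₀ : Mor G Cyl
  i₀ = mor (_↑ˡ n) (λ {a} {b} e → ≡.subst₂ (Edge G) (≡.sym (base-↑ˡ a)) (≡.sym (base-↑ˡ b)) e)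

  i₁ : Mor G Cyl
  i₁ = mor (n ↑ʳ_) (λ {a} {b} e → ≡.subst₂ (Edge G) (≡.sym (base-↑ʳ a)) (≡.sym (base-↑ʳ b)) e)

  p∘i₀≐p∘i₁ : (p ∘M i₀) ≐ (p ∘M i₁)
  p∘i₀≐p∘i₁ a = ≡.trans (base-↑ˡ a) (≡.sym (base-↑ʳ a))

  -- i₀ ∘ p is one step away from the identity in Cyl^Cyl, so p is a
  -- homotopy equivalence with homotopy inverse i₀
  i₀∘p—id : ExpAdj Cyl Cyl (fun (i₀ ∘M p)) (fun (idMor {Cyl}))
  i₀∘p—id x y e = ≡.subst (λ u → Edge G u (base y)) (≡.sym (base-↑ˡ (base x))) e

  p-isHomotopyEquivalence : IsHomotopyEquivalence p
  p-isHomotopyEquivalence =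
    i₀ , step {g = idMor} i₀∘p—id (done (λ _ → ≡.refl)) , done base-↑ˡ

  -- An adjacency f — g in H^G is a morphism Cyl G → H from f to g.
  module Lift {H : Graph} (f g : Mor G H) (f—g : ExpAdj G H (fun f) (fun g)) where
    lift-fun : Fin n ⊎ Fin n → V H
    lift-fun = [ fun f , fun g ]′

    lift-pres : (s t : Fin n ⊎ Fin n) →
                Edge G (reduce s) (reduce t) →
                Edge H (lift-fun s) (lift-fun t)
    lift-pres (inj₁ x) (inj₁ y) e = pres f e
    lift-pres (inj₁ x) (inj₂ y) e = f—g x y e
    lift-pres (inj₂ x) (inj₁ y) e = edge-sym H (f—g y x (edge-sym G e))
    lift-pres (inj₂ x) (inj₂ y) e = pres g e

    lift : Mor Cyl H
    lift = mor (λ x → lift-fun (splitAt n x))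
               (λ {x} {y} e → lift-pres (splitAt n x) (splitAt n y) e)

    lift∘i₀≐f : (lift ∘M i₀) ≐ f
    lift∘i₀≐f x = ≡.cong lift-fun (splitAt-↑ˡ n x n)

    lift∘i₁≐g : (lift ∘M i₁) ≐ g
    lift∘i₁≐g x = ≡.cong lift-fun (splitAt-↑ʳ n n x)

module HomotopyInvariance {o ℓ e} (C : Category o ℓ e) (F : Functor Gph C)
                          (inverts : InvertsHomotopyEquivalences {C = C} F) where
  open Category C
  open HomLaws C

  -- F cannot distinguish the two ends of a cylinder: F p is invertible and
  -- p ∘ i₀ = p ∘ i₁.
  ends-identified : ∀ G → F₁ F (Cylinder.i₀ G) ≈ F₁ F (Cylinder.i₁ G)
  ends-identified G = iso-cancelˡ C (inverts p p-isHomotopyEquivalence) (begin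
    F₁ F p ∘ F₁ F i₀   ≈⟨ ≈-sym (homomorphism F) ⟩
    F₁ F (p ∘M i₀)     ≈⟨ F-resp-≈ F {f = p ∘M i₀} {g = p ∘M i₁} p∘i₀≐p∘i₁ ⟩
    F₁ F (p ∘M i₁)     ≈⟨ homomorphism F ⟩
    F₁ F p ∘ F₁ F i₁   ∎)
    where
      open Cylinder G
      open SetoidReasoning (homSetoid C (F₀ F G) (F₀ F G))

  adjacent-identified : ∀ {G H} (f g : Mor G H) → ExpAdj G H (fun f) (fun g) →
                        F₁ F f ≈ F₁ F g
  adjacent-identified {G} {H} f g f—g = begin
    F₁ F f                 ≈⟨ F-resp-≈ F {f = f} {g = lift ∘M i₀} (λ v → ≡.sym (lift∘i₀≐f v)) ⟩
    F₁ F (lift ∘M i₀)      ≈⟨ homomorphism F ⟩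
    F₁ F lift ∘ F₁ F i₀    ≈⟨ ∘-resp-≈ ≈-refl (ends-identified G) ⟩
    F₁ F lift ∘ F₁ F i₁    ≈⟨ ≈-sym (homomorphism F) ⟩
    F₁ F (lift ∘M i₁)      ≈⟨ F-resp-≈ F {f = lift ∘M i₁} {g = g} lift∘i₁≐g ⟩
    F₁ F g                 ∎
    where
      open Cylinder G
      open Lift f g f—g
      open SetoidReasoning (homSetoid C (F₀ F G) (F₀ F H))

  homotopic-identified : ∀ {G H} {f g : Mor G H} → Homotopic f g → F₁ F f ≈ F₁ F g
  homotopic-identified (done f≐g)            = F-resp-≈ F f≐g
  homotopic-identified (step {f} {g} f—g rest) =
    ≈-trans (adjacent-identified f g f—g) (homotopic-identified rest)

  factor : Functor HoGph C
  factor = record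
    { F₀ = F₀ F
    ; F₁ = F₁ F
    ; F-resp-≈ = homotopic-identified
    ; identity = identity F
    ; homomorphism = homomorphism F }

  factor-factors : (factor ∘F Ψ) ≡F F
  factor-factors = record { eq₀ = λ _ → ≡.refl ; eq₁ = λ _ → ≈-refl }

  -- Ψ is the identity on objects and morphisms, so F″ Ψ = F already says
  -- that F″ agrees with F, i.e. with the factorisation, on both.
  factor-unique : (F″ : Functor HoGph C) → (F″ ∘F Ψ) ≡F F → F″ ≡F factor
  factor-unique F″ F″∘Ψ≡F = record { eq₀ = _≡F_.eq₀ F″∘Ψ≡F ; eq₁ = _≡F_.eq₁ F″∘Ψ≡F }

theorem5p1 : ∀ {o ℓ e} (C : Category o ℓ e) (F : Functor Gph C) →
    InvertsHomotopyEquivalences {C = C} F →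
    Σ (Functor HoGph C) λ F′ →
    ((F′ ∘F Ψ) ≡F F) × (∀ (F″ : Functor HoGph C) → (F″ ∘F Ψ) ≡F F → F″ ≡F F′)
theorem5p1 C F inverts = factor , factor-factors , factor-unique
  where open HomotopyInvariance C F inverts
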